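{- Let $U$ be a countably infinite set and $\mathrm{G}$ a subgroup of $\mathfrak{S}(U)$. For every $C\in\widehat{\overline{\mathrm{G}}[U]}$ the following are equivalent: (i) $C$ is completely meet-irreducible in the poset $(\widehat{\overline{\mathrm{G}}[U]};\subseteq)$; (ii) $C\in\overline{\mathrm{G}}[U]$ and there is an element $x\in U\setminus C$ such that $C$ is maximal (for inclusion) among the copies in $\overline{\mathrm{G}}[U]$ not containing $x$.
   Context: $\overline{\mathrm{G}}$ is the closure of $\mathrm{G}$ in $U^U$ for the function topology (maps $f:U\to U$ such that every finite restriction of $f$ is a restriction of some $g\in\mathrm{G}$); $\overline{\mathrm{G}}[U]=\{f[U]\mid f\in\overline{\mathrm{G}}\}$ is the set of copies; $\widehat{\overline{\mathrm{G}}[U]}$ is the set of intersections of families of copies. An element $u$ of a poset $P$ is completely meet-irreducible if there is $u^+\in P$ with $u^+>u$ and $y\geq u^+$ for every $y\in P$ with $y>u$. -}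

module Defs where

open import Level using (0ℓ)
open import Data.Product using (Σ; ∃; _×_; _,_)
open import Data.List using (List)
open import Data.List.Membership.Propositional using (_∈_)
open import Function.Bundles using (_↔_)
open import Relation.Nullary using (¬_)
open import Relation.Binary.PropositionalEquality using (_≡_)

Subset : Set → Set₁
Subset U = U → Set

module _ {U : Set} where

  _⊆_ : Subset U → Subset U → Set
  A ⊆ B = ∀ x → A x → B x

  _≐_ : Subset U → Subset U → Set
  A ≐ B = (A ⊆ B) × (B ⊆ A)

  _⊂_ : Subset U → Subset U → Set
  A ⊂ B = (A ⊆ B) × ¬ (B ⊆ A)

  Im : (U → U) → Subset U
  Im f y = ∃ λ x → f x ≡ y

  _≗_ : (U → U) → (U → U) → Set
  f ≗ g = ∀ x → f x ≡ g x

  record IsSubgroupOfSym (G : (U → U) → Set) : Set where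
    field
      respects : ∀ f g → f ≗ g → G f → G g
      identity : G (λ x → x)
      compose  : ∀ f g → G f → G g → G (λ x → f (g x))
      inverse  : ∀ f → G f →
                   Σ (U → U) λ g → G g × ((λ x → g (f x)) ≗ (λ x → x))
                                       × ((λ x → f (g x)) ≗ (λ x → x))

  -- closure of G in U^U for the function (pointwise convergence) topology:
  -- every finite restriction of f is a restriction of some g ∈ G
  Closure : ((U → U) → Set) → (U → U) → Set
  Closure G f = (F : List U) → Σ (U → U) λ g → G g × (∀ x → x ∈ F → f x ≡ g x)

  IsCopy : ((U → U) → Set) → Subset U → Set
  IsCopy G C = Σ (U → U) λ f → Closure G f × (C ≐ Im f)

  ⋂Im : ((U → U) → Set) → Subset U
  ⋂Im S y = ∀ f → S f → Im f y

  -- C ∈ ̂(Ḡ[U]) : C is the intersection of a family of copies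
  -- (the family is indexed by a set S ⊆ Ḡ of maps; the empty family gives U)
  IsMeetOfCopies : ((U → U) → Set) → Subset U → Set₁
  IsMeetOfCopies G C =
    Σ ((U → U) → Set) λ S → (∀ f → S f → Closure G f) × (C ≐ ⋂Im S)

  CompletelyMeetIrreducible : ((U → U) → Set) → Subset U → Set₁
  CompletelyMeetIrreducible G C =
    Σ (Subset U) λ C⁺ → IsMeetOfCopies G C⁺ × (C ⊂ C⁺) ×
      (∀ Y → IsMeetOfCopies G Y → C ⊂ Y → C⁺ ⊆ Y)

  MaximalCopyAvoiding : ((U → U) → Set) → U → Subset U → Set₁
  MaximalCopyAvoiding G x C =
    ∀ (D : Subset U) → IsCopy G D → ¬ D x → C ⊆ D → D ⊆ C

-- If C has an upper cover C⁺ in the meets of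
-- copies, pick x ∈ C⁺ ∖ C and a copy f[U] of the family defining C that
-- misses x; every meet of copies above C that misses x cannot lie strictly
-- above C, which makes f[U] = C and C maximal among copies avoiding x.
-- Conversely, if C is maximal among copies avoiding x ∉ C, then the
-- intersection of all copies strictly above C contains x and is the cover.
module Submission where

open import Defs
open import Level using (0ℓ)
open import Data.Nat using (ℕ)
open import Data.Product using (Σ; ∃; _×_; _,_)
open import Function.Bundles using (_↔_; _⇔_; mk⇔)
open import Relation.Nullary using (¬_)
open import Relation.Binary.PropositionalEquality using (_≡_; refl)
open import Axiom.ExcludedMiddle using (ExcludedMiddle)
open import Axiom.DoubleNegationElimination
  using (DoubleNegationElimination; em⇒dne)

module _ {U : Set} where

  Im-isCopy : ∀ {G f} → Closure G f → IsCopy G (Im {U} f)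
  Im-isCopy {f = f} clf = f , clf , (λ _ z → z) , (λ _ z → z)

  isCopy⇒isMeetOfCopies : ∀ {G} {D : Subset U} → IsCopy G D → IsMeetOfCopies G D
  isCopy⇒isMeetOfCopies (f , clf , D⊆Imf , Imf⊆D) =
    (λ g → g ≡ f) , (λ { _ refl → clf }) ,
    (λ y Dy → λ { _ refl → D⊆Imf y Dy }) , (λ y y∈⋂ → Imf⊆D y (y∈⋂ f refl))

  CopiesStrictlyAbove : ((U → U) → Set) → Subset U → (U → U) → Set
  CopiesStrictlyAbove G C g = Closure G g × C ⊂ Im g

  ⋂CopiesStrictlyAbove-isMeetOfCopies : ∀ G C →
    IsMeetOfCopies G (⋂Im (CopiesStrictlyAbove G C))
  ⋂CopiesStrictlyAbove-isMeetOfCopies G C =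
    CopiesStrictlyAbove G C , (λ _ (clg , _) → clg) , (λ _ z → z) , (λ _ z → z)

  ⊆-⋂CopiesStrictlyAbove : ∀ G C → C ⊆ ⋂Im (CopiesStrictlyAbove G C)
  ⊆-⋂CopiesStrictlyAbove G C y Cy g (_ , C⊆Img , _) = C⊆Img y Cy

  -- Each copy g[U] in a family whose meet Y lies strictly above C is itself
  -- strictly above C, since g[U] ⊆ C would force Y ⊆ C.
  ⋂CopiesStrictlyAbove-least : ∀ {G C} Y → IsMeetOfCopies G Y → C ⊂ Y →
    ⋂Im (CopiesStrictlyAbove G C) ⊆ Y
  ⋂CopiesStrictlyAbove-least Y (S , cl , Y⊆⋂ , ⋂⊆Y) (C⊆Y , Y⊈C) y y∈⋂ =
    ⋂⊆Y y λ g Sg → y∈⋂ g (cl g Sg , C⊆Img g Sg , Img⊈C g Sg)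
    where
    C⊆Img : ∀ g → S g → _ ⊆ Im g
    C⊆Img g Sg z Cz = Y⊆⋂ z (C⊆Y z Cz) g Sg
    Img⊈C : ∀ g → S g → ¬ (Im g ⊆ _)
    Img⊈C g Sg Img⊆C = Y⊈C λ z Yz → Img⊆C z (Y⊆⋂ z Yz g Sg)

module Classical (dne : DoubleNegationElimination 0ℓ) where

  ⊈⇒∃ : {X : Set} {A B : Subset X} → ¬ (A ⊆ B) → ∃ λ x → A x × ¬ B x
  ⊈⇒∃ A⊈B = dne λ ¬∃ → A⊈B λ x Ax → dne λ ¬Bx → ¬∃ (x , Ax , ¬Bx)

  module _ {U : Set} {G : (U → U) → Set} {C : Subset U} where

    cover-avoiding⇒⊆ : ∀ {C⁺ Y x} →
      (∀ Y → IsMeetOfCopies G Y → C ⊂ Y → C⁺ ⊆ Y) → C⁺ x →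
      IsMeetOfCopies G Y → C ⊆ Y → ¬ Y x → Y ⊆ C
    cover-avoiding⇒⊆ cover C⁺x mY C⊆Y ¬Yx =
      dne λ Y⊈C → ¬Yx (cover _ mY (C⊆Y , Y⊈C) _ C⁺x)

    completelyMeetIrreducible⇒maximalCopyAvoiding :
      IsMeetOfCopies G C → CompletelyMeetIrreducible G C →
      IsCopy G C × Σ U λ x → ¬ C x × MaximalCopyAvoiding G x C
    completelyMeetIrreducible⇒maximalCopyAvoiding
      (S , cl , C⊆⋂ , ⋂⊆C) (C⁺ , _ , (_ , C⁺⊈C) , cover)
      with ⊈⇒∃ C⁺⊈C
    ... | x , C⁺x , ¬Cx with ⊈⇒∃ {A = S} {B = λ f → Im f x} (λ x∈⋂ → ¬Cx (⋂⊆C x x∈⋂))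
    ... | f , Sf , ¬Imfx =
      (f , cl f Sf , C⊆Imf , maximal (Im f) (Im-isCopy (cl f Sf)) ¬Imfx C⊆Imf) ,
      x , ¬Cx , maximal
      where
      C⊆Imf : C ⊆ Im f
      C⊆Imf y Cy = C⊆⋂ y Cy f Sf
      maximal : MaximalCopyAvoiding G x C
      maximal D cD ¬Dx C⊆D =
        cover-avoiding⇒⊆ cover C⁺x (isCopy⇒isMeetOfCopies cD) C⊆D ¬Dx

    maximalCopyAvoiding⇒completelyMeetIrreducible : ∀ {x} →
      ¬ C x → MaximalCopyAvoiding G x C → CompletelyMeetIrreducible G C
    maximalCopyAvoiding⇒completelyMeetIrreducible {x} ¬Cx maximal =
      ⋂Im (CopiesStrictlyAbove G C) ,
      ⋂CopiesStrictlyAbove-isMeetOfCopies G C ,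
      (⊆-⋂CopiesStrictlyAbove G C , λ ⋂⊆C → ¬Cx (⋂⊆C x x∈⋂)) ,
      ⋂CopiesStrictlyAbove-least
      where
      x∈⋂ : ⋂Im (CopiesStrictlyAbove G C) x
      x∈⋂ g (clg , C⊆Img , Img⊈C) =
        dne λ ¬Imgx → Img⊈C (maximal (Im g) (Im-isCopy clg) ¬Imgx C⊆Img)

lemma9p2 : ExcludedMiddle 0ℓ →
    (U : Set) → U ↔ ℕ →
    (G : (U → U) → Set) → IsSubgroupOfSym G →
    (C : Subset U) → IsMeetOfCopies G C →
    CompletelyMeetIrreducible G C ⇔
    (IsCopy G C × Σ U λ x → ¬ C x × MaximalCopyAvoiding G x C)
lemma9p2 em U _ G _ C mC =
  mk⇔ (completelyMeetIrreducible⇒maximalCopyAvoiding mC)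
      (λ (_ , x , ¬Cx , maximal) →
        maximalCopyAvoiding⇒completelyMeetIrreducible ¬Cx maximal)
  where open Classical (em⇒dne em)
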